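{- If $G$ is a $(2P_1+P_3,\,K_4-e,\,C_5)$-free graph that contains an induced $C_7$, then $G$ is isomorphic to $C_7$.
   Context: All graphs are finite and simple. $P_\ell$, $C_\ell$ are the induced path and cycle on $\ell$ vertices; $K_4-e$ is $K_4$ minus an edge; $2P_1+P_3$ is the disjoint union of two isolated vertices and a $P_3$. "$(H_1,\dots,H_t)$-free" means no induced subgraph isomorphic to any $H_i$. -}

module Defs where

open import Data.Nat using (ℕ; suc; _+_; _∸_; _≡ᵇ_; _%_)
open import Data.Fin using (Fin; zero; suc; toℕ)
open import Data.Bool using (Bool; true; false; _∨_; _∧_)
open import Data.Bool.Properties using (∨-comm)
open import Relation.Binary.PropositionalEquality using (_≡_; refl)
open import Relation.Nullary using (¬_)
open import Function.Definitions using (Injective)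
open import Function.Bundles using (_⤖_; Bijection)

record Graph : Set where
  field
    n    : ℕ
    adj  : Fin n → Fin n → Bool
    sym  : ∀ u v → adj u v ≡ adj v u
    irr  : ∀ v → adj v v ≡ false
open Graph public

record InducedEmbedding (H G : Graph) : Set where
  field
    f      : Fin (n H) → Fin (n G)
    inj    : Injective _≡_ _≡_ f
    pres   : ∀ u v → adj G (f u) (f v) ≡ adj H u v

Contains : Graph → Graph → Set
Contains G H = InducedEmbedding H G

Free : Graph → Graph → Set
Free G H = ¬ Contains G H

record _≅_ (G H : Graph) : Set where
  field
    bij  : Fin (n G) ⤖ Fin (n H)
    pres : ∀ u v → adj H (Bijection.to bij u) (Bijection.to bij v) ≡ adj G u v

symℕ : ∀ {k} → (ℕ → ℕ → Bool) → Fin k → Fin k → Bool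
symℕ e u v = e (toℕ u) (toℕ v) ∨ e (toℕ v) (toℕ u)

symℕ-sym : ∀ {k} (e : ℕ → ℕ → Bool) (u v : Fin k) → symℕ e u v ≡ symℕ e v u
symℕ-sym e u v = ∨-comm (e (toℕ u) (toℕ v)) (e (toℕ v) (toℕ u))

-- cycle edges on 0..ℓ-1 : i ~ (i+1) mod ℓ
cycE : ℕ → ℕ → ℕ → Bool
cycE ℓ i j = ((suc i) % suc (ℓ ∸ 1)) ≡ᵇ j

C5 : Graph
C5 = record { n = 5 ; adj = symℕ (cycE 5) ; sym = symℕ-sym (cycE 5) ; irr = irr5 }
  where
  irr5 : ∀ v → symℕ (cycE 5) v v ≡ false
  irr5 zero = refl
  irr5 (suc zero) = refl
  irr5 (suc (suc zero)) = refl
  irr5 (suc (suc (suc zero))) = refl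
  irr5 (suc (suc (suc (suc zero)))) = refl

C7 : Graph
C7 = record { n = 7 ; adj = symℕ (cycE 7) ; sym = symℕ-sym (cycE 7) ; irr = irr7 }
  where
  irr7 : ∀ v → symℕ (cycE 7) v v ≡ false
  irr7 zero = refl
  irr7 (suc zero) = refl
  irr7 (suc (suc zero)) = refl
  irr7 (suc (suc (suc zero))) = refl
  irr7 (suc (suc (suc (suc zero)))) = refl
  irr7 (suc (suc (suc (suc (suc zero))))) = refl
  irr7 (suc (suc (suc (suc (suc (suc zero)))))) = refl

k4eE : ℕ → ℕ → Bool
k4eE i j = ((i ≡ᵇ 0) ∧ ((j ≡ᵇ 1) ∨ (j ≡ᵇ 2) ∨ (j ≡ᵇ 3))) ∨ ((i ≡ᵇ 1) ∧ ((j ≡ᵇ 2) ∨ (j ≡ᵇ 3)))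

K4-e : Graph
K4-e = record { n = 4 ; adj = symℕ k4eE ; sym = symℕ-sym k4eE ; irr = irr4 }
  where
  irr4 : ∀ v → symℕ k4eE v v ≡ false
  irr4 zero = refl
  irr4 (suc zero) = refl
  irr4 (suc (suc zero)) = refl
  irr4 (suc (suc (suc zero))) = refl

p3E : ℕ → ℕ → Bool
p3E i j = ((i ≡ᵇ 2) ∧ (j ≡ᵇ 3)) ∨ ((i ≡ᵇ 3) ∧ (j ≡ᵇ 4))

2P1+P3 : Graph
2P1+P3 = record { n = 5 ; adj = symℕ p3E ; sym = symℕ-sym p3E ; irr = irrP }
  where
  irrP : ∀ v → symℕ p3E v v ≡ false
  irrP zero = refl
  irrP (suc zero) = refl
  irrP (suc (suc zero)) = refl
  irrP (suc (suc (suc zero))) = refl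
  irrP (suc (suc (suc (suc zero)))) = refl

-- An induced C7 in G that misses some vertex w yields an induced subgraph of G
-- on C7 plus w, determined by the set of cycle vertices adjacent to w.  Each of
-- the 2^7 possible neighbourhoods creates an induced 2P1+P3, K4-e or C5, as a
-- backtracking search over all of them confirms.  So the induced C7 covers
-- every vertex of G and is therefore an isomorphism.
module Submission where

open import Defs hiding (sym)
open import Data.Nat using (zero; suc)
open import Data.Fin using (Fin; zero; suc; _≟_)
open import Data.Fin.Properties using (any?; all?)
open import Data.Bool using (Bool; true; false; _∧_; not)
import Data.Bool.Properties as Bool
open import Data.List using (List; []; _∷_; foldr; map; allFin)
open import Data.Maybe using (Maybe; just; nothing; _<∣>_; Is-just; to-witness)
import Data.Maybe as Maybe
import Data.Maybe.Relation.Unary.Any as Any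
open import Data.Maybe.Effectful using (applicative)
open import Data.Vec using (Vec; []; _∷_; lookup; tabulate; replicate; _[_]≔_)
open import Data.Vec.Properties using (lookup∘tabulate)
open import Data.Vec.Effectful using (module TraversableA)
open import Data.Product using (_,_; proj₁; proj₂)
open import Data.Sum using (_⊎_; inj₁; inj₂; [_,_])
open import Data.Unit using (tt)
open import Data.Empty using (⊥-elim)
open import Function using (_∘_)
open import Level using (0ℓ)
open import Function.Definitions using (StrictlySurjective)
open import Function.Bundles using (mk↔ₛ′)
open import Function.Properties.Inverse using (↔⇒⤖)
open import Relation.Nullary using (¬_; Dec; yes; no)
open import Relation.Nullary.Decidable using (map′; from-yes; _×-dec_; _→-dec_; isYes)
open import Relation.Binary.PropositionalEquality
  using (_≡_; _≢_; refl; sym; trans; cong; cong₂)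

open InducedEmbedding

∘-embedding : {K H G : Graph} → InducedEmbedding H G → InducedEmbedding K H → InducedEmbedding K G
∘-embedding E F = record
  { f    = f E ∘ f F
  ; inj  = inj F ∘ inj E
  ; pres = λ u v → trans (pres E (f F u) (f F v)) (pres F u v)
  }

surjective-embedding⇒≅ : {H G : Graph} (E : InducedEmbedding H G) →
                         StrictlySurjective _≡_ (f E) → G ≅ H
surjective-embedding⇒≅ {H} {G} E surj = record
  { bij  = ↔⇒⤖ (mk↔ₛ′ preimage (f E) (λ i → inj E (f∘preimage (f E i))) f∘preimage)
  ; pres = λ u v → trans (sym (pres E (preimage u) (preimage v)))
                         (cong₂ (adj G) (f∘preimage u) (f∘preimage v))
  }
  where
  preimage : Fin (n G) → Fin (n H)
  preimage = proj₁ ∘ surj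

  f∘preimage : ∀ w → f E (preimage w) ≡ w
  f∘preimage = proj₂ ∘ surj

addVertex : (H : Graph) → Vec Bool (n H) → Graph
addVertex H N = record { n = suc (n H) ; adj = adj⁺ ; sym = sym⁺ ; irr = irr⁺ }
  where
  adj⁺ : Fin (suc (n H)) → Fin (suc (n H)) → Bool
  adj⁺ zero    zero    = false
  adj⁺ zero    (suc v) = lookup N v
  adj⁺ (suc u) zero    = lookup N u
  adj⁺ (suc u) (suc v) = adj H u v

  sym⁺ : ∀ u v → adj⁺ u v ≡ adj⁺ v u
  sym⁺ zero    zero    = refl
  sym⁺ zero    (suc v) = refl
  sym⁺ (suc u) zero    = refl
  sym⁺ (suc u) (suc v) = Graph.sym H u v

  irr⁺ : ∀ v → adj⁺ v v ≡ false
  irr⁺ zero    = refl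
  irr⁺ (suc v) = irr H v

neighbours : {H : Graph} (G : Graph) → InducedEmbedding H G → Fin (n G) → Vec Bool (n H)
neighbours G E w = tabulate (λ i → adj G w (f E i))

addVertex-embedding : {H G : Graph} (E : InducedEmbedding H G) (w : Fin (n G)) →
                      (∀ i → f E i ≢ w) → InducedEmbedding (addVertex H (neighbours G E w)) G
addVertex-embedding {H} {G} E w w∉E = record { f = f⁺ ; inj = inj⁺ ; pres = pres⁺ }
  where
  f⁺ : Fin (suc (n H)) → Fin (n G)
  f⁺ zero    = w
  f⁺ (suc i) = f E i

  inj⁺ : ∀ {u v} → f⁺ u ≡ f⁺ v → u ≡ v
  inj⁺ {zero}  {zero}  _ = refl
  inj⁺ {zero}  {suc j} e = ⊥-elim (w∉E j (sym e))
  inj⁺ {suc i} {zero}  e = ⊥-elim (w∉E i e)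
  inj⁺ {suc i} {suc j} e = cong suc (inj E e)

  pres⁺ : ∀ u v → adj G (f⁺ u) (f⁺ v) ≡ adj (addVertex H (neighbours G E w)) u v
  pres⁺ zero    zero    = irr G w
  pres⁺ zero    (suc j) = sym (lookup∘tabulate (λ i → adj G w (f E i)) j)
  pres⁺ (suc i) zero    = trans (Graph.sym G (f E i) w)
                                (sym (lookup∘tabulate (λ i → adj G w (f E i)) i))
  pres⁺ (suc i) (suc j) = pres E i j

inducedEmbedding? : (H G : Graph) → (Fin (n H) → Fin (n G)) → Maybe (InducedEmbedding H G)
inducedEmbedding? H G φ
  with all? (λ u → all? (λ v → (φ u ≟ φ v) →-dec (u ≟ v)))
     | all? (λ u → all? (λ v → adj G (φ u) (φ v) Bool.≟ adj H u v))
... | yes injective | yes preserving =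
  just record { f = φ ; inj = λ {u} {v} → injective u v ; pres = preserving }
... | _ | _ = nothing

-- Only the final candidate is certified (by inducedEmbedding?), so the pruning
-- test fits needs no correctness proof.
module Search (H G : Graph) where
  open TraversableA (applicative {f = 0ℓ}) using (sequenceA)

  Placement : Set
  Placement = Vec (Maybe (Fin (n G))) (n H)

  fits : Placement → Fin (n H) → Fin (n G) → Bool
  fits ψ u x = foldr _∧_ true (map fitsWith (allFin (n H)))
    where
    fitsWith : Fin (n H) → Bool
    fitsWith v with lookup ψ v
    ... | nothing = true
    ... | just y  = isYes (adj G x y Bool.≟ adj H u v) ∧ not (isYes (x ≟ y))

  extendPlacement : List (Fin (n H)) → Placement → Maybe (InducedEmbedding H G)
  extendPlacement []       ψ = Maybe._>>=_ (sequenceA ψ) (inducedEmbedding? H G ∘ lookup)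
  extendPlacement (u ∷ us) ψ = foldr _<∣>_ nothing (map place (allFin (n G)))
    where
    place : Fin (n G) → Maybe (InducedEmbedding H G)
    place x with fits ψ u x
    ... | true  = extendPlacement us (ψ [ u ]≔ just x)
    ... | false = nothing

  findEmbedding : Maybe (InducedEmbedding H G)
  findEmbedding = extendPlacement (allFin (n H)) (replicate (n H) nothing)

Forbidden : Graph → Set
Forbidden G = Contains G 2P1+P3 ⊎ Contains G K4-e ⊎ Contains G C5

findForbidden : (G : Graph) → Maybe (Forbidden G)
findForbidden G =
  Maybe.map inj₁ (Search.findEmbedding 2P1+P3 G) <∣>
  Maybe.map (inj₂ ∘ inj₁) (Search.findEmbedding K4-e G) <∣>
  Maybe.map (inj₂ ∘ inj₂) (Search.findEmbedding C5 G)

Forbidden-mono : {G G′ : Graph} → Contains G G′ → Forbidden G′ → Forbidden G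
Forbidden-mono E = [ inj₁ ∘ ∘-embedding E , [ inj₂ ∘ inj₁ ∘ ∘-embedding E , inj₂ ∘ inj₂ ∘ ∘-embedding E ] ]

∀-Vec-Bool? : ∀ {k} {P : Vec Bool k → Set} → (∀ v → Dec (P v)) → Dec (∀ v → P v)
∀-Vec-Bool? {zero}  P? = map′ (λ { p [] → p }) (λ p → p []) (P? [])
∀-Vec-Bool? {suc k} P? =
  map′ (λ { (pᶠ , pᵗ) (false ∷ v) → pᶠ v ; (pᶠ , pᵗ) (true ∷ v) → pᵗ v })
       (λ p → p ∘ (false ∷_) , p ∘ (true ∷_))
       (∀-Vec-Bool? (P? ∘ (false ∷_)) ×-dec ∀-Vec-Bool? (P? ∘ (true ∷_)))

addVertex-C7-forbidden : (N : Vec Bool 7) → Forbidden (addVertex C7 N)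
addVertex-C7-forbidden N = to-witness (allFound N)
  where
  allFound : ∀ N → Is-just (findForbidden (addVertex C7 N))
  allFound = from-yes (∀-Vec-Bool? (λ N → Any.dec (λ _ → yes tt) (findForbidden (addVertex C7 N))))

induced-C7-spanning : (G : Graph) → ¬ Forbidden G → (E : InducedEmbedding C7 G) →
                      StrictlySurjective _≡_ (f E)
induced-C7-spanning G free E w with any? (λ i → f E i ≟ w)
... | yes hit = hit
... | no miss = ⊥-elim (free (Forbidden-mono (addVertex-embedding E w (λ i e → miss (i , e)))
                                             (addVertex-C7-forbidden (neighbours G E w))))

lemma5p4 : (G : Graph) → Free G 2P1+P3 → Free G K4-e → Free G C5 →
    Contains G C7 → G ≅ C7
lemma5p4 G freeP freeK freeC E =
  surjective-embedding⇒≅ E (induced-C7-spanning G [ freeP , [ freeK , freeC ] ] E)
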